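{- Let $\Lambda$ be a finite connected bipartite cubic graph whose automorphism group acts transitively on the $2$-darts of $\Lambda$. Then $\mathrm{A^2D}(\Lambda)$ is a connected $2$-valent reversible dart-transitive digraph, and its underlying graph $\mathrm{A^2G}(\Lambda)$ is a connected tetravalent dart-transitive graph.
   Context: A digraph is a pair $({\mathcal V},{\mathcal D})$ with ${\mathcal V}$ a finite non-empty set and ${\mathcal D}$ a set of ordered pairs of distinct vertices (darts); a graph is a digraph with ${\mathcal D}={\mathcal D}^{ -1}$, where ${\mathcal D}^{ -1}=\{(v,u):(u,v)\in{\mathcal D}\}$. The underlying graph of a digraph is $({\mathcal V},{\mathcal D}\cup{\mathcal D}^{ -1})$; a digraph is connected if its underlying graph is. A digraph is $2$-valent if every vertex has in-valence and out-valence $2$; it is reversible if it is isomorphic to $({\mathcal V},{\mathcal D}^{ -1})$; it is dart-transitive if its automorphism group is transitive on its darts. A $2$-dart of a graph $\Lambda$ is a pair $(x,y)$ of darts such that the terminal vertex of $x$ equals the initial vertex of $y$ and the initial vertex of $x$ differs from the terminal vertex of $y$. $\mathrm{A^2D}(\Lambda)$ is the digraph with vertex set ${\mathcal D}(\Lambda)\times{\mathcal D}(\Lambda)$ in which $\bigl((x,y),(z,w)\bigr)$ is a dart iff $y=z$ and $(x,w)$ is a $2$-dart of $\Lambda$; $\mathrm{A^2G}(\Lambda)$ is its underlying graph. -}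

module Defs where

open import Level using (0ℓ)
open import Data.Nat using (ℕ)
open import Data.Fin using (Fin)
open import Data.Bool using (Bool)
open import Data.Product using (Σ; Σ-syntax; ∃; ∃-syntax; _×_; _,_; proj₁; proj₂)
open import Data.Sum using (_⊎_)
open import Data.List using (List; length)
open import Data.List.Membership.Propositional using (_∈_)
open import Data.List.Relation.Unary.Unique.Propositional using (Unique)
open import Relation.Binary.PropositionalEquality using (_≡_; _≢_)
open import Relation.Binary.Construct.Closure.ReflexiveTransitive using (Star)
open import Relation.Nullary using (¬_)
open import Function.Bundles using (_↔_; Inverse)

record Digraph : Set₁ where
  field
    V   : Set
    _⇒_ : V → V → Set
open Digraph public

-- Standing assumptions of "digraph": V finite and non-empty, darts join
-- distinct vertices, and the dart relation is proposition-valued (so that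
-- D really is a *set* of ordered pairs).
IsDigraph : Digraph → Set
IsDigraph Γ =
  (∃[ n ] (V Γ ↔ Fin n)) × V Γ ×
  (∀ u → ¬ (_⇒_ Γ u u)) × (∀ {u v} (p q : _⇒_ Γ u v) → p ≡ q)

IsGraph : Digraph → Set
IsGraph Γ = IsDigraph Γ × (∀ u v → _⇒_ Γ u v → _⇒_ Γ v u)

Dart : Digraph → Set
Dart Γ = Σ[ u ∈ V Γ ] Σ[ v ∈ V Γ ] (_⇒_ Γ u v)

init : ∀ {Γ} → Dart Γ → V Γ
init (u , _ , _) = u

term : ∀ {Γ} → Dart Γ → V Γ
term (_ , v , _) = v

Is2Dart : ∀ Γ → Dart Γ → Dart Γ → Set
Is2Dart Γ x y = (term {Γ} x ≡ init {Γ} y) × (init {Γ} x ≢ term {Γ} y)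

Underlying : Digraph → Digraph
Underlying Γ = record { V = V Γ ; _⇒_ = λ u v → _⇒_ Γ u v ⊎ _⇒_ Γ v u }

Connected : Digraph → Set
Connected Γ = ∀ u v → Star (_⇒_ (Underlying Γ)) u v

HasCard : {A : Set} → (A → Set) → ℕ → Set
HasCard {A} R k = Σ[ xs ∈ List A ] (length xs ≡ k × Unique xs × (∀ w → (R w → w ∈ xs) × (w ∈ xs → R w)))

OutValence InValence : (Γ : Digraph) → V Γ → ℕ → Set
OutValence Γ v k = HasCard (λ w → _⇒_ Γ v w) k
InValence  Γ v k = HasCard (λ w → _⇒_ Γ w v) k

Regular : Digraph → ℕ → Set
Regular Γ k = ∀ v → OutValence Γ v k × InValence Γ v k

Cubic : Digraph → Set
Cubic Γ = IsGraph Γ × Regular Γ 3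

Bipartite : Digraph → Set
Bipartite Γ = Σ[ c ∈ (V Γ → Bool) ] (∀ u v → _⇒_ Γ u v → c u ≢ c v)

record Iso (Γ Δ : Digraph) : Set where
  field
    bij  : V Γ ↔ V Δ
  open Inverse bij public using (to)
  field
    pres : ∀ u v → _⇒_ Γ u v → _⇒_ Δ (to u) (to v)
    refl' : ∀ u v → _⇒_ Δ (to u) (to v) → _⇒_ Γ u v

Aut : Digraph → Set
Aut Γ = Iso Γ Γ

actDart : ∀ {Γ} → Aut Γ → Dart Γ → Dart Γ
actDart g (u , v , p) = Iso.to g u , Iso.to g v , Iso.pres g u v p

DartTransitive : Digraph → Set
-- stated on the endpoints, so that it does not depend on the identity of
-- proofs of u ⇒ v (relevant for underlying graphs, whose relation is a sum)
DartTransitive Γ = ∀ (x y : Dart Γ) → Σ[ g ∈ Aut Γ ]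
  ((Iso.to g (init {Γ} x) ≡ init {Γ} y) × (Iso.to g (term {Γ} x) ≡ term {Γ} y))

TwoDartTransitive : Digraph → Set
TwoDartTransitive Γ = ∀ (x y x' y' : Dart Γ) → Is2Dart Γ x y → Is2Dart Γ x' y' →
  Σ[ g ∈ Aut Γ ] ((actDart {Γ} g x ≡ x') × (actDart {Γ} g y ≡ y'))

Reverse : Digraph → Digraph
Reverse Γ = record { V = V Γ ; _⇒_ = λ u v → _⇒_ Γ v u }

Reversible : Digraph → Set
Reversible Γ = Iso Γ (Reverse Γ)

A2D : Digraph → Digraph
A2D Λ = record
  { V = Dart Λ × Dart Λ
  ; _⇒_ = λ { (x , y) (z , w) → (y ≡ z) × Is2Dart Λ x w } }

A2G : Digraph → Digraph
A2G Λ = Underlying (A2D Λ)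

-- Reversing both darts, (x , y) ↦ (y⁻¹ , x⁻¹), reverses A²D(Λ), and A²D(Λ) has no 2-cycles;
-- so A²G(Λ) inherits connectivity, valence 2 + 2 and dart-transitivity from A²D(Λ).
--
-- Connectivity: a vertex (x , y) of A²D(Λ) is joined to every (x' , y') with the same head
-- of x and tail of y, so it suffices to connect pairs (u , v) of vertices of Λ.  Along a walk
-- of Λ these pairs move within and between the four classes given by the colours of u and v,
-- and one step (u , v) ↦ (v , neighbour of u) permutes the classes cyclically.
--
-- Dart-transitivity: given darts (x , y) → (y , w) and (x' , y') → (y' , w') of A²D(Λ),
-- 2-dart-transitivity gives g with g x = x', g w = w', and dart-transitivity some h with
-- h y = y'.  The map applying g and h to alternate darts of every directed path is an
-- automorphism: which dart of a vertex (a , b) receives g is decided by the parity of the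
-- colours of the tails of a and b, which flips along every dart of A²D(Λ).
module Submission where

open import Defs
open import Algebra.Bundles using (CommutativeRing)
open import Data.Bool using (Bool; true; false; not; _xor_)
open import Data.Bool.Properties using (¬-not; xor-assoc; xor-comm; xor-same; xor-inverseʳ; xor-annihilates-not; not-distribʳ-xor; xor-∧-commutativeRing)
open import Data.Empty using (⊥-elim)
open import Data.Fin.Properties using (inj⇒≟)
open import Data.List using ([]; _∷_; _++_; map)
open import Data.List.Properties using (length-map; length-++)
open import Data.List.Membership.Propositional using (_∈_)
open import Data.List.Membership.Propositional.Properties using (∈-map⁺; ∈-map⁻; ∈-++⁺ˡ; ∈-++⁺ʳ; ∈-++⁻)
open import Data.List.Relation.Unary.AllPairs using ([]; _∷_)
open import Data.List.Relation.Unary.All using ([]; _∷_)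
open import Data.List.Relation.Unary.Any using (here; there)
import Data.List.Relation.Unary.Unique.Propositional.Properties as Unique
open import Data.Nat using (ℕ; zero; suc; _+_)
open import Data.Nat.GeneralisedArithmetic using (iterate)
open import Data.Product using (∃-syntax; ∃₂; _×_; _,_; proj₁; proj₂)
open import Data.Sum using (_⊎_; inj₁; inj₂; [_,_]; swap)
import Data.Sum as Sum
open import Function.Base using (id; _∘_)
open import Function.Bundles using (_↔_; Inverse; mk↔ₛ′)
open import Function.Properties.Inverse using (↔⇒↣)
open import Relation.Binary.Construct.Closure.ReflexiveTransitive using (Star; ε; _◅_; _◅◅_; gmap)
import Relation.Binary.Construct.Closure.ReflexiveTransitive as Star
open import Relation.Binary.Definitions using (DecidableEquality)
open import Relation.Binary.PropositionalEquality hiding ([_])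
open import Relation.Nullary using (¬_; Dec; yes; no)
open import Relation.Nullary.Decidable using (_⊎-dec_)
open import Algebra.Properties.CommutativeSemigroup (CommutativeRing.+-commutativeSemigroup xor-∧-commutativeRing) using (interchange)

open ≡-Reasoning

xor-cancelˡ : ∀ a b → a xor (a xor b) ≡ b
xor-cancelˡ a b = trans (sym (xor-assoc a a b)) (cong (_xor b) (xor-same a))

xor-cancelʳ : ∀ a b → (a xor b) xor b ≡ a
xor-cancelʳ a b = trans (xor-comm (a xor b) b) (trans (cong (b xor_) (xor-comm a b)) (xor-cancelˡ b a))

xor-transpose : ∀ {m a b} → a ≡ m xor b → b ≡ m xor a
xor-transpose {m} {a} {b} eq = trans (sym (xor-cancelˡ m b)) (cong (m xor_) (sym eq))

third-outside-pair : {A : Set} {a b d x y : A} → a ≢ b → a ≢ d → b ≢ d →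
  a ≡ x ⊎ a ≡ y → b ≡ x ⊎ b ≡ y → ¬ (d ≡ x ⊎ d ≡ y)
third-outside-pair a≢b _   _   (inj₁ refl) (inj₁ refl) _           = a≢b refl
third-outside-pair a≢b _   _   (inj₂ refl) (inj₂ refl) _           = a≢b refl
third-outside-pair _   a≢d _   (inj₁ refl) (inj₂ refl) (inj₁ refl) = a≢d refl
third-outside-pair _   _   b≢d (inj₁ refl) (inj₂ refl) (inj₂ refl) = b≢d refl
third-outside-pair _   _   b≢d (inj₂ refl) (inj₁ refl) (inj₁ refl) = b≢d refl
third-outside-pair _   a≢d _   (inj₂ refl) (inj₁ refl) (inj₂ refl) = a≢d refl

HasCard-⊎ : {A : Set} {P Q : A → Set} {k l : ℕ} → (∀ a → P a → ¬ Q a) →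
  HasCard P k → HasCard Q l → HasCard (λ a → P a ⊎ Q a) (k + l)
HasCard-⊎ disjoint (xs , |xs| , xs! , xs⇔) (ys , |ys| , ys! , ys⇔) =
  xs ++ ys ,
  trans (length-++ xs) (cong₂ _+_ |xs| |ys|) ,
  Unique.++⁺ xs! ys! (λ (a∈xs , a∈ys) →
    disjoint _ (proj₂ (xs⇔ _) a∈xs) (proj₂ (ys⇔ _) a∈ys)) ,
  λ a → [ ∈-++⁺ˡ ∘ proj₁ (xs⇔ a) , ∈-++⁺ʳ xs ∘ proj₁ (ys⇔ a) ] ,
        Sum.map (proj₂ (xs⇔ a)) (proj₂ (ys⇔ a)) ∘ ∈-++⁻ xs

HasCard-↔ : {A B : Set} {P : A → Set} {Q : B → Set} {k : ℕ} (e : A ↔ B) →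
  (∀ a → P a → Q (Inverse.to e a)) → (∀ b → Q b → P (Inverse.from e b)) →
  HasCard Q k → HasCard P k
HasCard-↔ {P = P} e P⇒Q Q⇒P (ys , |ys| , ys! , ys⇔) =
  map from ys ,
  trans (length-map from ys) |ys| ,
  Unique.map⁺ from-injective ys! ,
  λ a → (λ pa → subst (_∈ map from ys) (strictlyInverseʳ a)
                  (∈-map⁺ from (proj₁ (ys⇔ _) (P⇒Q a pa)))) ,
        (λ a∈ → let b , b∈ys , a≡ = ∈-map⁻ from a∈
                in subst P (sym a≡) (Q⇒P b (proj₂ (ys⇔ b) b∈ys)))
  where
    open Inverse e
    from-injective : ∀ {b b'} → from b ≡ from b' → b ≡ b'
    from-injective {b} {b'} eq =
      trans (sym (strictlyInverseˡ b)) (trans (cong to eq) (strictlyInverseˡ b'))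

mkIso : {Γ Δ : Digraph} (f : V Γ → V Δ) (f⁻¹ : V Δ → V Γ) →
  (∀ y → f (f⁻¹ y) ≡ y) → (∀ x → f⁻¹ (f x) ≡ x) →
  (∀ u v → _⇒_ Γ u v → _⇒_ Δ (f u) (f v)) →
  (∀ u v → _⇒_ Δ u v → _⇒_ Γ (f⁻¹ u) (f⁻¹ v)) → Iso Γ Δ
mkIso {Γ} f f⁻¹ f∘f⁻¹ f⁻¹∘f pres pres⁻¹ = record
  { bij   = mk↔ₛ′ f f⁻¹ f∘f⁻¹ f⁻¹∘f
  ; pres  = pres
  ; refl' = λ u v p → subst₂ (_⇒_ Γ) (f⁻¹∘f u) (f⁻¹∘f v) (pres⁻¹ _ _ p)
  }

module _ {Γ Δ : Digraph} (g : Iso Γ Δ) where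
  open Iso g using (to)

  from : V Δ → V Γ
  from = Inverse.from (Iso.bij g)

  to-from : ∀ y → to (from y) ≡ y
  to-from = Inverse.strictlyInverseˡ (Iso.bij g)

  from-to : ∀ x → from (to x) ≡ x
  from-to = Inverse.strictlyInverseʳ (Iso.bij g)

  from-pres : ∀ u v → _⇒_ Δ u v → _⇒_ Γ (from u) (from v)
  from-pres u v p = Iso.refl' g _ _ (subst₂ (_⇒_ Δ) (sym (to-from u)) (sym (to-from v)) p)

  to-injective : ∀ {x y} → to x ≡ to y → x ≡ y
  to-injective {x} {y} eq = trans (sym (from-to x)) (trans (cong from eq) (from-to y))

  Iso-sym : Iso Δ Γ
  Iso-sym = mkIso from to from-to to-from from-pres (Iso.pres g)

Iso-trans : {Γ Δ Θ : Digraph} → Iso Γ Δ → Iso Δ Θ → Iso Γ Θ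
Iso-trans g h = mkIso (Iso.to h ∘ Iso.to g) (from g ∘ from h)
  (λ z → trans (cong (Iso.to h) (to-from g _)) (to-from h z))
  (λ x → trans (cong (from g) (from-to h _)) (from-to g x))
  (λ u v → Iso.pres h _ _ ∘ Iso.pres g u v)
  (λ u v → from-pres g _ _ ∘ from-pres h u v)

module _ {Γ : Digraph} where

  outValence⇒Regular : ∀ {k} → Reversible Γ → (∀ v → OutValence Γ v k) → Regular Γ k
  outValence⇒Regular ρ out v = out v ,
    HasCard-↔ (Iso.bij ρ) (λ w → Iso.pres ρ w v)
      (λ w p → subst (_⇒_ Γ (from ρ w)) (from-to ρ v) (from-pres ρ w (Iso.to ρ v) p))
      (out (Iso.to ρ v))

  Underlying-connected : Connected Γ → Connected (Underlying Γ)
  Underlying-connected conn u v = gmap id inj₁ (conn u v)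

  Underlying-regular : ∀ {k} → (∀ u v → _⇒_ Γ u v → ¬ _⇒_ Γ v u) →
    Regular Γ k → Regular (Underlying Γ) (k + k)
  Underlying-regular asym reg v =
    HasCard-⊎ (λ w p q → asym v w p q) (proj₁ (reg v)) (proj₂ (reg v)) ,
    HasCard-⊎ (λ w p q → asym w v p q) (proj₂ (reg v)) (proj₁ (reg v))

  Underlying-lift : {f : V Γ → V Γ} →
    (∀ u v → _⇒_ Γ u v → _⇒_ (Underlying Γ) (f u) (f v)) →
    ∀ u v → _⇒_ (Underlying Γ) u v → _⇒_ (Underlying Γ) (f u) (f v)
  Underlying-lift h u v (inj₁ p) = h u v p
  Underlying-lift h u v (inj₂ p) = swap (h v u p)

  Aut-Underlying : Aut Γ → Aut (Underlying Γ)
  Aut-Underlying g = mkIso (Iso.to g) (from g) (to-from g) (from-to g)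
    (Underlying-lift λ u v → inj₁ ∘ Iso.pres g u v)
    (Underlying-lift λ u v → inj₁ ∘ from-pres g u v)

  Reversible⇒Aut-Underlying : Reversible Γ → Aut (Underlying Γ)
  Reversible⇒Aut-Underlying ρ = mkIso (Iso.to ρ) (from ρ) (to-from ρ) (from-to ρ)
    (Underlying-lift λ u v → inj₂ ∘ Iso.pres ρ u v)
    (Underlying-lift λ u v → inj₂ ∘ from-pres ρ v u)

  Underlying-dartTransitive : Reversible Γ → DartTransitive Γ → DartTransitive (Underlying Γ)
  Underlying-dartTransitive ρ dt (a , b , inj₁ p) (a' , b' , inj₁ p')
    with dt (a , b , p) (a' , b' , p')
  ... | g , ga , gb = Aut-Underlying g , ga , gb
  Underlying-dartTransitive ρ dt (a , b , inj₁ p) (a' , b' , inj₂ p')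
    with dt (Iso.to ρ b , Iso.to ρ a , Iso.pres ρ a b p) (b' , a' , p')
  ... | g , gb , ga = Iso-trans (Reversible⇒Aut-Underlying ρ) (Aut-Underlying g) , ga , gb
  Underlying-dartTransitive ρ dt (a , b , inj₂ p) (a' , b' , inj₁ p')
    with dt (Iso.to ρ a , Iso.to ρ b , Iso.pres ρ b a p) (a' , b' , p')
  ... | g , ga , gb = Iso-trans (Reversible⇒Aut-Underlying ρ) (Aut-Underlying g) , ga , gb
  Underlying-dartTransitive ρ dt (a , b , inj₂ p) (a' , b' , inj₂ p')
    with dt (b , a , p) (b' , a' , p')
  ... | g , gb , ga = Aut-Underlying g , ga , gb

module A2D-properties (Λ : Digraph) (isGraph : IsGraph Λ) where

  W : Set
  W = V Λ

  D : Set
  D = Dart Λ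

  _⟶_ : W → W → Set
  _⟶_ = _⇒_ Λ

  _⇛_ : D × D → D × D → Set
  _⇛_ = _⇒_ (A2D Λ)

  src tgt : D → W
  src = init {Λ}
  tgt = term {Λ}

  edge : (x : D) → src x ⟶ tgt x
  edge (_ , _ , p) = p

  loopless : ∀ u → ¬ (u ⟶ u)
  loopless = proj₁ (proj₂ (proj₂ (proj₁ isGraph)))

  edge-irrelevant : ∀ {u v} (p q : u ⟶ v) → p ≡ q
  edge-irrelevant = proj₂ (proj₂ (proj₂ (proj₁ isGraph)))

  ⟶-sym : ∀ {u v} → u ⟶ v → v ⟶ u
  ⟶-sym = proj₂ isGraph _ _

  _≟_ : DecidableEquality W
  _≟_ = inj⇒≟ (↔⇒↣ (proj₂ (proj₁ (proj₁ isGraph))))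

  v₀ : W
  v₀ = proj₁ (proj₂ (proj₁ isGraph))

  Dart-≡ : ∀ {x y : D} → src x ≡ src y → tgt x ≡ tgt y → x ≡ y
  Dart-≡ {u , v , p} {.u , .v , q} refl refl = cong (λ r → u , v , r) (edge-irrelevant p q)

  opposite : D → D
  opposite (u , v , p) = v , u , ⟶-sym p

  reversal : D × D → D × D
  reversal (x , y) = opposite y , opposite x

  reversal-involutive : ∀ X → reversal (reversal X) ≡ X
  reversal-involutive (x , y) = cong₂ _,_ (Dart-≡ refl refl) (Dart-≡ refl refl)

  reversal-reverses : ∀ X Y → X ⇛ Y → reversal Y ⇛ reversal X
  reversal-reverses (x , y) (.y , w) (refl , t , s) = refl , sym t , s ∘ sym

  A2D-reversible : Reversible (A2D Λ)
  A2D-reversible = mkIso {A2D Λ} {Reverse (A2D Λ)} reversal reversal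
    reversal-involutive reversal-involutive reversal-reverses (λ X Y → reversal-reverses Y X)

  A2D-asymmetric : ∀ X Y → X ⇛ Y → ¬ (Y ⇛ X)
  A2D-asymmetric (x , y) (.y , w) (refl , t , _) (w≡x , _) =
    loopless (src x) (subst (src x ⟶_) (trans t (cong src w≡x)) (edge x))

  module Cubic (cubic : Regular Λ 3) where

    record Neighbourhood (v : W) : Set where
      field
        n₁ n₂ n₃ : W
        edge₁    : v ⟶ n₁
        edge₂    : v ⟶ n₂
        edge₃    : v ⟶ n₃
        n₁≢n₂    : n₁ ≢ n₂
        n₁≢n₃    : n₁ ≢ n₃
        n₂≢n₃    : n₂ ≢ n₃
        complete : ∀ w → v ⟶ w → w ≡ n₁ ⊎ w ≡ n₂ ⊎ w ≡ n₃

    neighbourhood : ∀ v → Neighbourhood v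
    neighbourhood v with proj₁ (cubic v)
    ... | n₁ ∷ n₂ ∷ n₃ ∷ [] , refl , (n₁≢n₂ ∷ n₁≢n₃ ∷ []) ∷ (n₂≢n₃ ∷ []) ∷ [] ∷ [] , ∈⇔ = record
      { n₁ = n₁ ; n₂ = n₂ ; n₃ = n₃
      ; edge₁ = proj₂ (∈⇔ n₁) (here refl)
      ; edge₂ = proj₂ (∈⇔ n₂) (there (here refl))
      ; edge₃ = proj₂ (∈⇔ n₃) (there (there (here refl)))
      ; n₁≢n₂ = n₁≢n₂ ; n₁≢n₃ = n₁≢n₃ ; n₂≢n₃ = n₂≢n₃
      ; complete = λ w p → position (proj₁ (∈⇔ w) p)
      }
      where
        position : ∀ {w} → w ∈ n₁ ∷ n₂ ∷ n₃ ∷ [] → w ≡ n₁ ⊎ w ≡ n₂ ⊎ w ≡ n₃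
        position (here e)                 = inj₁ e
        position (there (here e))         = inj₂ (inj₁ e)
        position (there (there (here e))) = inj₂ (inj₂ e)

    neighbour : W → W
    neighbour v = Neighbourhood.n₁ (neighbourhood v)

    neighbour-edge : ∀ v → v ⟶ neighbour v
    neighbour-edge v = Neighbourhood.edge₁ (neighbourhood v)

    neighbour-avoiding : ∀ v x y → ∃[ n ] (v ⟶ n × n ≢ x × n ≢ y)
    neighbour-avoiding v x y = choose (hits? n₁) (hits? n₂)
      where
        open Neighbourhood (neighbourhood v)
        hits? : ∀ n → Dec (n ≡ x ⊎ n ≡ y)
        hits? n = (n ≟ x) ⊎-dec (n ≟ y)
        avoiding : ∀ {n} → v ⟶ n → ¬ (n ≡ x ⊎ n ≡ y) →
          ∃[ n ] (v ⟶ n × n ≢ x × n ≢ y)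
        avoiding p miss = _ , p , miss ∘ inj₁ , miss ∘ inj₂
        choose : Dec (n₁ ≡ x ⊎ n₁ ≡ y) → Dec (n₂ ≡ x ⊎ n₂ ≡ y) →
          ∃[ n ] (v ⟶ n × n ≢ x × n ≢ y)
        choose (no miss)    _          = avoiding edge₁ miss
        choose (yes _)      (no miss)  = avoiding edge₂ miss
        choose (yes hit₁)   (yes hit₂) =
          avoiding edge₃ (third-outside-pair n₁≢n₂ n₁≢n₃ n₂≢n₃ hit₁ hit₂)

    extension : D → D
    extension x =
      let n , p , _ = neighbour-avoiding (tgt x) (src x) (src x) in tgt x , n , p

    extension-2dart : ∀ x → Is2Dart Λ x (extension x)
    extension-2dart x =
      let _ , _ , n≢x , _ = neighbour-avoiding (tgt x) (src x) (src x) in refl , n≢x ∘ sym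

    record OtherNeighbours (v z : W) : Set where
      field
        m₁ m₂    : W
        edge₁    : v ⟶ m₁
        edge₂    : v ⟶ m₂
        m₁≢m₂    : m₁ ≢ m₂
        m₁≢z     : m₁ ≢ z
        m₂≢z     : m₂ ≢ z
        complete : ∀ w → v ⟶ w → w ≢ z → w ≡ m₁ ⊎ w ≡ m₂

    otherNeighbours : ∀ {v z} → v ⟶ z → OtherNeighbours v z
    otherNeighbours {v} {z} p = others (complete z p)
      where
        open Neighbourhood (neighbourhood v)
        others : ∀ {z} → z ≡ n₁ ⊎ z ≡ n₂ ⊎ z ≡ n₃ → OtherNeighbours v z
        others (inj₁ refl) = record
          { m₁ = n₂ ; m₂ = n₃ ; edge₁ = edge₂ ; edge₂ = edge₃
          ; m₁≢m₂ = n₂≢n₃ ; m₁≢z = ≢-sym n₁≢n₂ ; m₂≢z = ≢-sym n₁≢n₃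
          ; complete = λ w q w≢z → [ ⊥-elim ∘ w≢z , id ] (complete w q) }
        others (inj₂ (inj₁ refl)) = record
          { m₁ = n₁ ; m₂ = n₃ ; edge₁ = edge₁ ; edge₂ = edge₃
          ; m₁≢m₂ = n₁≢n₃ ; m₁≢z = n₁≢n₂ ; m₂≢z = ≢-sym n₂≢n₃
          ; complete = λ w q w≢z → [ inj₁ , [ ⊥-elim ∘ w≢z , inj₂ ] ] (complete w q) }
        others (inj₂ (inj₂ refl)) = record
          { m₁ = n₁ ; m₂ = n₂ ; edge₁ = edge₁ ; edge₂ = edge₂
          ; m₁≢m₂ = n₁≢n₂ ; m₁≢z = n₁≢n₃ ; m₂≢z = n₂≢n₃
          ; complete = λ w q w≢z → [ inj₁ , [ inj₂ , ⊥-elim ∘ w≢z ] ] (complete w q) }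

    A2D-outValence : ∀ X → OutValence (A2D Λ) X 2
    A2D-outValence (x , y) =
      (y , d₁) ∷ (y , d₂) ∷ [] , refl , (d₁≢d₂ ∷ []) ∷ [] ∷ [] , λ Z → out⇒∈ Z , ∈⇒out Z
      where
        open OtherNeighbours (otherNeighbours (⟶-sym (edge x)))
        d₁ d₂ : D
        d₁ = tgt x , m₁ , edge₁
        d₂ = tgt x , m₂ , edge₂
        d₁≢d₂ : (y , d₁) ≢ (y , d₂)
        d₁≢d₂ = m₁≢m₂ ∘ cong (tgt ∘ proj₂)
        out⇒∈ : ∀ Z → (x , y) ⇛ Z → Z ∈ (y , d₁) ∷ (y , d₂) ∷ []
        out⇒∈ (.y , w) (refl , t , s)
          with complete (tgt w) (subst (_⟶ tgt w) (sym t) (edge w)) (s ∘ sym)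
        ... | inj₁ e = here (cong (y ,_) (Dart-≡ (sym t) e))
        ... | inj₂ e = there (here (cong (y ,_) (Dart-≡ (sym t) e)))
        ∈⇒out : ∀ Z → Z ∈ (y , d₁) ∷ (y , d₂) ∷ [] → (x , y) ⇛ Z
        ∈⇒out _ (here refl)         = refl , refl , ≢-sym m₁≢z
        ∈⇒out _ (there (here refl)) = refl , refl , ≢-sym m₂≢z

    A2D-regular : Regular (A2D Λ) 2
    A2D-regular = outValence⇒Regular A2D-reversible A2D-outValence

    -- Connectivity

    outDart inDart : W → D
    outDart v = v , neighbour v , neighbour-edge v
    inDart v = opposite (outDart v)

    K : W → W → D × D
    K u v = inDart u , outDart v

    _~_ : D × D → D × D → Set
    _~_ = Star (_⇒_ (A2G Λ))

    ~-sym : ∀ {X Y} → X ~ Y → Y ~ X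
    ~-sym = Star.reverse swap

    ⇛⇒~ : ∀ {X Y} → X ⇛ Y → X ~ Y
    ⇛⇒~ p = inj₁ p ◅ ε

    ⇚⇒~ : ∀ {X Y} → Y ⇛ X → X ~ Y
    ⇚⇒~ p = inj₂ p ◅ ε

    ~-tgt : ∀ x x' y → tgt x ≡ tgt x' → (x , y) ~ (x' , y)
    ~-tgt x x' y e with neighbour-avoiding (tgt x) (src x) (src x')
    ... | n , p , n≢x , n≢x' =
      ⇛⇒~ {Y = y , w} (refl , refl , n≢x ∘ sym) ◅◅
      ⇚⇒~ {Y = x' , y} (refl , sym e , n≢x' ∘ sym)
      where w = tgt x , n , p

    ~-src : ∀ x y y' → src y ≡ src y' → (x , y) ~ (x , y')
    ~-src x y y' e with neighbour-avoiding (src y) (tgt y) (tgt y')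
    ... | n , p , n≢y , n≢y' =
      ⇚⇒~ {Y = z , x} (refl , refl , n≢y) ◅◅ ⇛⇒~ {Y = x , y'} (refl , e , n≢y')
      where z = n , src y , ⟶-sym p

    ~-K : ∀ x y → (x , y) ~ K (tgt x) (src y)
    ~-K x y = ~-tgt x (inDart (tgt x)) y refl ◅◅ ~-src (inDart (tgt x)) y (outDart (src y)) refl

    K-step : ∀ u v v' → v ⟶ v' → K u v ~ K v' u
    K-step u v v' p =
      ~-sym (~-K (inDart u) y) ◅◅
      ⇛⇒~ (refl , extension-2dart (inDart u)) ◅◅
      ~-K y (extension (inDart u))
      where y = v , v' , p

    module Connected-bipartite (conn : Connected Λ) (bip : Bipartite Λ) where

      colour : W → Bool
      colour = proj₁ bip

      colour-≢ : ∀ {u v} → u ⟶ v → colour u ≢ colour v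
      colour-≢ = proj₂ bip _ _

      colour-flip : ∀ {u v} → u ⟶ v → colour v ≡ not (colour u)
      colour-flip p = ¬-not (colour-≢ (⟶-sym p))

      undirect : ∀ {u v} → _⇒_ (Underlying Λ) u v → u ⟶ v
      undirect (inj₁ p) = p
      undirect (inj₂ p) = ⟶-sym p

      K-parity : ∀ {b v} → Star (_⇒_ (Underlying Λ)) b v →
        (colour b ≡ colour v → ∀ u → K u b ~ K u v) ×
        (colour b ≢ colour v → ∀ u → K b u ~ K u v)
      K-parity ε = (λ _ _ → ε) , (λ b≢b → ⊥-elim (b≢b refl))
      K-parity {b} {v} (s ◅ walk) = even , odd
        where
          p = undirect s
          even : colour b ≡ colour v → ∀ u → K u b ~ K u v
          even same u = K-step u b _ p ◅◅
                        proj₂ (K-parity walk) (λ e → colour-≢ p (trans same (sym e))) u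
          odd : colour b ≢ colour v → ∀ u → K b u ~ K u v
          odd diff u = ~-sym (K-step u _ b (⟶-sym p)) ◅◅
                       proj₁ (K-parity walk) (trans (colour-flip p) (sym (¬-not (≢-sym diff)))) u

      K-odd : ∀ {b v} → colour b ≢ colour v → ∀ u → K b u ~ K u v
      K-odd {b} {v} = proj₂ (K-parity (conn b v))

      K-twoSteps : ∀ {a b v w} → colour a ≢ colour v → colour b ≢ colour w → K a b ~ K v w
      K-twoSteps {a} {b} {v} a≢v b≢w = K-odd a≢v b ◅◅ K-odd b≢w v

      colours : W → W → Bool × Bool
      colours a b = colour a , colour b

      K-same-colours : ∀ {a b a' b'} → colours a b ≡ colours a' b' → K a b ~ K a' b'
      K-same-colours {a} {b} eq =
        K-twoSteps a≢a₁ b≢b₁ ◅◅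
        ~-sym (K-twoSteps (subst (_≢ colour (neighbour a)) (cong proj₁ eq) a≢a₁)
                          (subst (_≢ colour (neighbour b)) (cong proj₂ eq) b≢b₁))
        where
          a≢a₁ : colour a ≢ colour (neighbour a)
          a≢a₁ = colour-≢ (neighbour-edge a)
          b≢b₁ : colour b ≢ colour (neighbour b)
          b≢b₁ = colour-≢ (neighbour-edge b)

      rotate : Bool × Bool → Bool × Bool
      rotate (α , β) = β , not α

      rotate-to-origin : ∀ c → ∃[ k ] iterate rotate c k ≡ (false , false)
      rotate-to-origin (false , false) = 0 , refl
      rotate-to-origin (true  , false) = 1 , refl
      rotate-to-origin (true  , true)  = 2 , refl
      rotate-to-origin (false , true)  = 3 , refl

      K-rotate : ∀ k a b →
        ∃₂ λ a' b' → K a b ~ K a' b' × colours a' b' ≡ iterate rotate (colours a b) k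
      K-rotate zero a b = a , b , ε , refl
      K-rotate (suc k) a b =
        let a' , b' , r , eq = K-rotate k b (neighbour a)
        in a' , b' , K-odd (colour-≢ (neighbour-edge a)) b ◅◅ r ,
           trans eq (cong (λ c → iterate rotate (colour b , c) k) (colour-flip (neighbour-edge a)))

      K-connected : ∀ a b a' b' → K a b ~ K a' b'
      K-connected a b a' b' =
        let k , kc = rotate-to-origin (colours a b)
            k' , kc' = rotate-to-origin (colours a' b')
            _ , _ , r , eq = K-rotate k a b
            _ , _ , r' , eq' = K-rotate k' a' b'
        in r ◅◅ K-same-colours (trans (trans eq kc) (sym (trans eq' kc'))) ◅◅ ~-sym r'

      A2D-connected : Connected (A2D Λ)
      A2D-connected (x , y) (x' , y') = ~-K x y ◅◅ K-connected _ _ _ _ ◅◅ ~-sym (~-K x' y')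

      -- Dart-transitivity

      act : Aut Λ → D → D
      act = actDart {Λ}

      act-2dart : ∀ g {x w} → Is2Dart Λ x w → Is2Dart Λ (act g x) (act g w)
      act-2dart g (t , s) = cong (Iso.to g) t , s ∘ to-injective g

      Undoes : Aut Λ → Aut Λ → Set
      Undoes p' p = ∀ x → act p' (act p x) ≡ x

      Iso-sym-undoes : ∀ g → Undoes (Iso-sym g) g
      Iso-sym-undoes g x = Dart-≡ (from-to g _) (from-to g _)

      undoes-Iso-sym : ∀ g → Undoes g (Iso-sym g)
      undoes-Iso-sym g x = Dart-≡ (to-from g _) (to-from g _)

      Λ-dartTransitive : TwoDartTransitive Λ → ∀ y y' → ∃[ g ] act g y ≡ y'
      Λ-dartTransitive tdt y y' =
        let g , gy , _ = tdt y (extension y) y' (extension y') (extension-2dart y) (extension-2dart y')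
        in g , gy

      colourChange : Aut Λ → W → Bool
      colourChange g u = colour (Iso.to g u) xor colour u

      colourChange-edge : ∀ (g : Aut Λ) {u v} → u ⟶ v → colourChange g v ≡ colourChange g u
      colourChange-edge g {u} {v} p =
        trans (cong₂ _xor_ (colour-flip (Iso.pres g u v p)) (colour-flip p))
              (xor-annihilates-not (colour (Iso.to g u)) (colour u))

      colourChange-walk : ∀ (g : Aut Λ) {u v} → Star (_⇒_ (Underlying Λ)) u v →
        colourChange g u ≡ colourChange g v
      colourChange-walk g ε = refl
      colourChange-walk g (s ◅ walk) =
        trans (sym (colourChange-edge g (undirect s))) (colourChange-walk g walk)

      colourShift : Aut Λ → Bool
      colourShift g = colourChange g v₀

      colour-shift : ∀ (g : Aut Λ) u → colour (Iso.to g u) ≡ colourShift g xor colour u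
      colour-shift g u = begin
          colour (Iso.to g u)
        ≡⟨ sym (xor-cancelʳ (colour (Iso.to g u)) (colour u)) ⟩
          colourChange g u xor colour u
        ≡⟨ cong (_xor colour u) (colourChange-walk g (conn u v₀)) ⟩
          colourShift g xor colour u
        ∎

      colourShift-Iso-sym : ∀ g → colourShift (Iso-sym g) ≡ colourShift g
      colourShift-Iso-sym g = begin
          colour (from g v₀) xor colour v₀
        ≡⟨ cong (_xor colour v₀) (xor-transpose {colourShift g} v₀-colour) ⟩
          (colourShift g xor colour v₀) xor colour v₀
        ≡⟨ xor-cancelʳ (colourShift g) (colour v₀) ⟩
          colourShift g
        ∎
        where
          v₀-colour : colour v₀ ≡ colourShift g xor colour (from g v₀)
          v₀-colour = trans (cong colour (sym (to-from g v₀))) (colour-shift g (from g v₀))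

      layer : D × D → Bool
      layer (a , b) = colour (src a) xor colour (src b)

      layer-flip : ∀ X Y → X ⇛ Y → layer Y ≡ not (layer X)
      layer-flip (x , y) (.y , w) (refl , t , _) = begin
          colour (src y) xor colour (src w)
        ≡⟨ cong (λ v → colour (src y) xor colour v) (sym t) ⟩
          colour (src y) xor colour (tgt x)
        ≡⟨ cong (colour (src y) xor_) (colour-flip (edge x)) ⟩
          colour (src y) xor not (colour (src x))
        ≡⟨ sym (not-distribʳ-xor (colour (src y)) (colour (src x))) ⟩
          not (colour (src y) xor colour (src x))
        ≡⟨ cong not (xor-comm (colour (src y)) (colour (src x))) ⟩
          not (layer (x , y))
        ∎

      layer-act : ∀ p q a b →
        layer (act p a , act q b) ≡ (colourShift p xor colourShift q) xor layer (a , b)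
      layer-act p q a b =
        trans (cong₂ _xor_ (colour-shift p (src a)) (colour-shift q (src b)))
              (interchange (colourShift p) (colour (src a)) (colourShift q) (colour (src b)))

      place : Bool → Aut Λ → Aut Λ → D × D → D × D
      place false p q (a , b) = act p a , act q b
      place true  p q (a , b) = act q a , act p b

      layer-place : ∀ s p q X →
        layer (place s p q X) ≡ (colourShift p xor colourShift q) xor layer X
      layer-place false p q (a , b) = layer-act p q a b
      layer-place true  p q (a , b) =
        trans (layer-act q p a b) (cong (_xor layer (a , b)) (xor-comm (colourShift q) (colourShift p)))

      place-preserves : ∀ s p q x y w → Is2Dart Λ x w →
        place s p q (x , y) ⇛ place (not s) p q (y , w)
      place-preserves false p q x y w t = refl , act-2dart p {x} {w} t
      place-preserves true  p q x y w t = refl , act-2dart q {x} {w} t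

      place-inverse : ∀ s {p q p' q'} → Undoes p' p → Undoes q' q →
        ∀ X → place s p' q' (place s p q X) ≡ X
      place-inverse false p'p q'q (a , b) = cong₂ _,_ (p'p a) (q'q b)
      place-inverse true  p'p q'q (a , b) = cong₂ _,_ (q'q a) (p'p b)

      -- The offset e makes the inverse again of this form: p and q shift every layer by
      -- colourShift p xor colourShift q, which the inverse absorbs into its offset.
      alternate : Bool → Aut Λ → Aut Λ → D × D → D × D
      alternate e p q X = place (e xor layer X) p q X

      alternate-preserves : ∀ e p q X Y → X ⇛ Y → alternate e p q X ⇛ alternate e p q Y
      alternate-preserves e p q (x , y) (.y , w) d@(refl , t) =
        subst (λ s → place (e xor layer (x , y)) p q (x , y) ⇛ place s p q (y , w)) (sym flipped)
              (place-preserves (e xor layer (x , y)) p q x y w t)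
        where
          flipped : e xor layer (y , w) ≡ not (e xor layer (x , y))
          flipped = trans (cong (e xor_) (layer-flip (x , y) (y , w) d)) (sym (not-distribʳ-xor e _))

      alternate-inverse : ∀ e e' {p q p' q'} → Undoes p' p → Undoes q' q →
        (∀ X → e' xor layer (alternate e p q X) ≡ e xor layer X) →
        ∀ X → alternate e' p' q' (alternate e p q X) ≡ X
      alternate-inverse e e' {p} {q} {p'} {q'} p'p q'q same X =
        trans (cong (λ s → place s p' q' (alternate e p q X)) (same X))
              (place-inverse (e xor layer X) p'p q'q X)

      alternate-aut : Bool → Aut Λ → Aut Λ → Aut (A2D Λ)
      alternate-aut e p q = mkIso (alternate e p q) (alternate e' p⁻¹ q⁻¹)
        right-inverse left-inverse (alternate-preserves e p q) (alternate-preserves e' p⁻¹ q⁻¹)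
        where
          E = colourShift p xor colourShift q
          e' = e xor E
          p⁻¹ = Iso-sym p
          q⁻¹ = Iso-sym q
          left-inverse : ∀ X → alternate e' p⁻¹ q⁻¹ (alternate e p q X) ≡ X
          left-inverse = alternate-inverse e e' (Iso-sym-undoes p) (Iso-sym-undoes q) λ X → begin
              e' xor layer (alternate e p q X)
            ≡⟨ cong (e' xor_) (layer-place (e xor layer X) p q X) ⟩
              (e xor E) xor (E xor layer X)
            ≡⟨ xor-assoc e E _ ⟩
              e xor (E xor (E xor layer X))
            ≡⟨ cong (e xor_) (xor-cancelˡ E (layer X)) ⟩
              e xor layer X
            ∎
          right-inverse : ∀ Y → alternate e p q (alternate e' p⁻¹ q⁻¹ Y) ≡ Y
          right-inverse = alternate-inverse e' e (undoes-Iso-sym p) (undoes-Iso-sym q) λ Y → begin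
              e xor layer (alternate e' p⁻¹ q⁻¹ Y)
            ≡⟨ cong (e xor_) (layer-place (e' xor layer Y) p⁻¹ q⁻¹ Y) ⟩
              e xor ((colourShift p⁻¹ xor colourShift q⁻¹) xor layer Y)
            ≡⟨ cong₂ (λ a b → e xor ((a xor b) xor layer Y))
                     (colourShift-Iso-sym p) (colourShift-Iso-sym q) ⟩
              e xor (E xor layer Y)
            ≡⟨ sym (xor-assoc e E (layer Y)) ⟩
              e' xor layer Y
            ∎

      A2D-dartTransitive : TwoDartTransitive Λ → DartTransitive (A2D Λ)
      A2D-dartTransitive tdt ((x , y) , (.y , w) , d@(refl , t)) ((x' , y') , (.y' , w') , (refl , t'))
        with tdt x w x' w' t t' | Λ-dartTransitive tdt y y'
      ... | g , gx , gw | h , hy = alternate-aut l g h , X↦X' , Y↦Y'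
        where
          l = layer (x , y)
          X↦X' : place (l xor l) g h (x , y) ≡ (x' , y')
          X↦X' = trans (cong (λ s → place s g h (x , y)) (xor-same l)) (cong₂ _,_ gx hy)
          Y↦Y' : place (l xor layer (y , w)) g h (y , w) ≡ (y' , w')
          Y↦Y' = trans (cong (λ s → place s g h (y , w))
                              (trans (cong (l xor_) (layer-flip (x , y) (y , w) d)) (xor-inverseʳ l)))
                       (cong₂ _,_ hy gw)

mainTheorem9 : (Λ : Digraph) → IsGraph Λ → Connected Λ → Bipartite Λ → Cubic Λ →
    TwoDartTransitive Λ →
    (Connected (A2D Λ) × Regular (A2D Λ) 2 × Reversible (A2D Λ) × DartTransitive (A2D Λ))
    × (Connected (A2G Λ) × Regular (A2G Λ) 4 × DartTransitive (A2G Λ))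
mainTheorem9 Λ isGraph conn bip (_ , cubic) tdt =
  (A2D-connected , A2D-regular , A2D-reversible , A2D-dartTransitive tdt) ,
  ( Underlying-connected A2D-connected
  , Underlying-regular A2D-asymmetric A2D-regular
  , Underlying-dartTransitive A2D-reversible (A2D-dartTransitive tdt) )
  where
    open A2D-properties Λ isGraph
    open Cubic cubic
    open Connected-bipartite conn bip
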